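{- Let $N\in\mathbb N$, let $\mathcal U(8N+5)=\{(x,y)\in\mathbb Z^2:x^2+y^2=8N+5\}$, let $\mathcal B'(N)=\{(q_1',q_2')\in\mathbb Z^2: q_1'+q_2'\text{ even},\ 2q_1'^2+2q_2'^2-2q_1'-q_2'=N\}$, and let $\varphi:\mathcal B'(N)\to\mathcal U(8N+5)$, $\varphi(q_1',q_2')=(4q_1'-2,\,4q_2'-1)$. Then: (1) the action of the dihedral group $D_8$ on $\mathcal U(8N+5)$ is free; (2) $\varphi(\mathcal B'(N))$ is a complete set of representatives of the $D_8$-orbits of $\mathcal U(8N+5)$.
   Context: $D_8=\langle r,s\mid r^4=s^2=(rs)^2=1\rangle$ acts on integer solutions of $x^2+y^2=k$ by $r(x,y)=(-y,x)$, $s(x,y)=(y,x)$. Origin of $\mathcal B'(N)$: in type $C_2^{(1)}$, with $M=\{\sqrt2(q_1\varepsilon_1+q_2\varepsilon_2):q_i\in\mathbb Z\}$, the $\Lambda_0$-atomic length is $4q_1^2+4q_2^2-3q_1-q_2$; the isometry $u=\frac1{\sqrt2}\begin{pmatrix}1&1\\1&-1\end{pmatrix}$ maps $M$ onto the pairs of integers with even sum, and $\mathcal B'(N)$ is the image under $u$ of the set of elements of $M$ of atomic length $N$ (these are in bijection with self-conjugate $4$-cores of size $N$). -}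

module Defs where

open import Data.Nat using (ℕ; suc)
open import Data.Integer using (ℤ; +_; _+_; _-_; _*_; -_)
open import Data.Integer.Divisibility using (_∣_)
open import Data.Fin using (Fin; toℕ)
open import Data.Bool using (Bool; true; false)
open import Data.Product using (_×_; _,_; Σ)
open import Relation.Binary.PropositionalEquality using (_≡_)

ℤ² : Set
ℤ² = ℤ × ℤ

r-act : ℤ² → ℤ² 
r-act (x , y) = (- y , x)

s-act : ℤ² → ℤ²
s-act (x , y) = (y , x)

r-pow : ℕ → ℤ² → ℤ²
r-pow 0 p = p
r-pow (suc n) p = r-act (r-pow n p)

-- Elements of D8 = ⟨ r , s ∣ r⁴ = s² = (rs)² = 1 ⟩, in the normal form r^i s^j
-- (i ∈ {0,1,2,3}, j ∈ {0,1}); these 8 words are the 8 distinct group elements.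
record D8 : Set where
  constructor rˢ
  field
    i : Fin 4
    j : Bool

e : D8
e = rˢ Data.Fin.zero false

act : D8 → ℤ² → ℤ²
act (rˢ i false) p = r-pow (toℕ i) p
act (rˢ i true) p = r-pow (toℕ i) (s-act p)

U : ℕ → ℤ² → Set
U k (x , y) = x * x + y * y ≡ + k

B' : ℕ → ℤ² → Set
B' N (q₁ , q₂) =
  (+ 2 ∣ q₁ + q₂) ×
  (+ 2 * (q₁ * q₁) + + 2 * (q₂ * q₂) - + 2 * q₁ - q₂ ≡ + N)

φ : ℤ² → ℤ²
φ (q₁ , q₂) = (+ 4 * q₁ - + 2 , + 4 * q₂ - + 1)

-- A sum of two squares that is 5 mod 8 has one singly even (2 mod 4) and one odd summand:
-- odd squares are 1 mod 8, and the square of an even number 2u is 4 mod 8 only when u is odd.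
-- So every point of 𝒰(8N+5) has nonzero coordinates of distinct parity, and no element of D8
-- other than the identity can fix it. If (x, y) has x singly even and y odd, the points of its
-- orbit of the shape (2 mod 4, 3 mod 4) are exactly (x, y′) and (−x, y′) for the right sign
-- y′ = ±y; they are φ(q₁, q₂) and φ(1 − q₁, q₂), and exactly one of q₁ + q₂ and 1 − q₁ + q₂
-- is even. Finally ∣φ(q)∣² = 8 (2q₁² + 2q₂² − 2q₁ − q₂) + 5, so for such points the quadratic
-- condition defining ℬ′(N) is just membership of φ(q) in 𝒰(8N+5).
module Submission where

open import Defs
open import Agda.Builtin.FromNat using (Number; fromNat)
open import Data.Bool using (true; false)
open import Data.Empty using (⊥; ⊥-elim)
open import Data.Fin using (toℕ)
open import Data.Fin.Patterns using (0F; 1F; 2F; 3F)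
open import Data.Integer
  using (ℤ; +_; -_; _+_; _-_; _*_; ∣_∣)
open import Data.Integer.DivMod using (_%ℕ_; _/ℕ_; n%ℕd<d; a≡a%ℕn+[a/ℕn]*n)
import Data.Integer.Divisibility as Unsigned
import Data.Integer.Divisibility.Signed as Signed
import Data.Integer.Literals as ℤ
open import Data.Integer.Properties
  using (neg-involutive; pos-+; pos-*; abs-*; *-cancelˡ-≡; *-comm; +-comm)
open import Data.Integer.Tactic.RingSolver using (solve-∀)
open import Data.Nat as ℕ using (ℕ; zero; suc; s≤s)
import Data.Nat.Literals as ℕ
open import Data.Nat.Properties using (m*n≡1⇒m≡1)
open import Data.Product using (Σ; ∃-syntax; _×_; _,_; proj₁; proj₂)
open import Data.Sum using (_⊎_; inj₁; inj₂)
open import Data.Unit using (tt)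
open import Relation.Binary.PropositionalEquality
  using (_≡_; _≢_; refl; sym; trans; cong; cong₂; ≢-sym; module ≡-Reasoning)

instance
  ℕ-number : Number ℕ
  ℕ-number = ℕ.number

  ℤ-number : Number ℤ
  ℤ-number = ℤ.number

2*i≢1 : ∀ i → 2 * i ≢ 1
2*i≢1 i eq with m*n≡1⇒m≡1 2 ∣ i ∣ (trans (sym (abs-* 2 i)) (cong ∣_∣ eq))
... | ()

Even Odd : ℤ → Set
Even z = ∃[ m ] z ≡ 2 * m
Odd z = ∃[ m ] z ≡ 2 * m + 1

even⊎odd : ∀ z → Even z ⊎ Odd z
even⊎odd z with z %ℕ 2 | n%ℕd<d z 2 | a≡a%ℕn+[a/ℕn]*n z 2
... | 0 | _ | eq = inj₁ (z /ℕ 2 , trans eq (lemma (z /ℕ 2)))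
  where lemma : ∀ m → 0 + m * 2 ≡ 2 * m
        lemma = solve-∀
... | 1 | _ | eq = inj₂ (z /ℕ 2 , trans eq (lemma (z /ℕ 2)))
  where lemma : ∀ m → 1 + m * 2 ≡ 2 * m + 1
        lemma = solve-∀
... | suc (suc _) | s≤s (s≤s ()) | _

even≢odd : ∀ {a b} → Even a → Odd b → a ≢ b
even≢odd (m , refl) (n , refl) eq = 2*i≢1 (m - n) (begin
  2 * (m - n)               ≡⟨ lemma m n ⟩
  2 * m - 2 * n             ≡⟨ cong (_- 2 * n) eq ⟩
  2 * n + 1 - 2 * n         ≡⟨ lemma′ n ⟩
  1                         ∎)
  where
  open ≡-Reasoning
  lemma : ∀ m n → 2 * (m - n) ≡ 2 * m - 2 * n
  lemma = solve-∀
  lemma′ : ∀ n → 2 * n + 1 - 2 * n ≡ 1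
  lemma′ = solve-∀

even-neg : ∀ {z} → Even z → Even (- z)
even-neg (m , refl) = - m , lemma m
  where lemma : ∀ m → - (2 * m) ≡ 2 * - m
        lemma = solve-∀

odd-neg : ∀ {z} → Odd z → Odd (- z)
odd-neg (m , refl) = - m - 1 , lemma m
  where lemma : ∀ m → - (2 * m + 1) ≡ 2 * (- m - 1) + 1
        lemma = solve-∀

odd⇒≢0 : ∀ {z} → Odd z → z ≢ 0
odd⇒≢0 oz z≡0 = even≢odd (0 , refl) oz (sym z≡0)

2∣⇒even : ∀ {z} → 2 Unsigned.∣ z → Even z
2∣⇒even 2∣z with Signed.∣ᵤ⇒∣ 2∣z
... | Signed.divides m eq = m , trans eq (*-comm m 2)

even⇒2∣ : ∀ {z} → Even z → 2 Unsigned.∣ z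
even⇒2∣ (m , eq) = Signed.∣⇒∣ᵤ (Signed.divides m (trans eq (*-comm 2 m)))

SinglyEven : ℤ → Set
SinglyEven z = ∃[ u ] (z ≡ 2 * u × Odd u)

singlyEven⇒even : ∀ {z} → SinglyEven z → Even z
singlyEven⇒even (u , eq , _) = u , eq

singlyEven⇒≢0 : ∀ {z} → SinglyEven z → z ≢ 0
singlyEven⇒≢0 (u , refl , ou) 2u≡0 = odd⇒≢0 ou (*-cancelˡ-≡ 2 u 0 2u≡0)

even⊎complement-even : ∀ q t → Even (q + t) ⊎ Even (1 - q + t)
even⊎complement-even q t with even⊎odd (q + t)
... | inj₁ ev = inj₁ ev
... | inj₂ (m , eq) = inj₂ (t - m , (begin
  1 - q + t              ≡⟨ lemma q t ⟩
  1 + 2 * t - (q + t)    ≡⟨ cong (λ w → 1 + 2 * t - w) eq ⟩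
  1 + 2 * t - (2 * m + 1) ≡⟨ lemma′ t m ⟩
  2 * (t - m)            ∎))
  where
  open ≡-Reasoning
  lemma : ∀ q t → 1 - q + t ≡ 1 + 2 * t - (q + t)
  lemma = solve-∀
  lemma′ : ∀ t m → 1 + 2 * t - (2 * m + 1) ≡ 2 * (t - m)
  lemma′ = solve-∀

¬even×complement-even : ∀ q t → Even (q + t) → Even (1 - q + t) → ⊥
¬even×complement-even q t (a , ea) (b , eb) =
  even≢odd (a + b , trans (cong₂ _+_ ea eb) (lemma a b)) (t , lemma′ q t) refl
  where
  lemma : ∀ a b → 2 * a + 2 * b ≡ 2 * (a + b)
  lemma = solve-∀
  lemma′ : ∀ q t → (q + t) + (1 - q + t) ≡ 2 * t + 1
  lemma′ = solve-∀

odd-square : ∀ {y} → Odd y → ∃[ t ] y * y ≡ 8 * t + 1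
odd-square (m , refl) with even⊎odd m
... | inj₁ (k , refl) = 2 * k * k + k , lemma k
  where lemma : ∀ k → (2 * (2 * k) + 1) * (2 * (2 * k) + 1) ≡ 8 * (2 * k * k + k) + 1
        lemma = solve-∀
... | inj₂ (k , refl) = 2 * k * k + 3 * k + 1 , lemma k
  where lemma : ∀ k → (2 * (2 * k + 1) + 1) * (2 * (2 * k + 1) + 1) ≡ 8 * (2 * k * k + 3 * k + 1) + 1
        lemma = solve-∀

odd-square⇒odd : ∀ {u} → Odd (u * u) → Odd u
odd-square⇒odd {u} ou with even⊎odd u
... | inj₂ ou′ = ou′
... | inj₁ (k , refl) = ⊥-elim (even≢odd (2 * (k * k) , lemma k) ou refl)
  where lemma : ∀ k → 2 * k * (2 * k) ≡ 2 * (2 * (k * k))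
        lemma = solve-∀

-- 4u² ≡ 4 mod 8 because the odd square y² is 1 mod 8.
even-summand⇒singlyEven : ∀ {x y n} → Even x → Odd y → x * x + y * y ≡ 8 * n + 5 → SinglyEven x
even-summand⇒singlyEven {y = y} {n} (u , refl) oy eq with odd-square oy
... | t , y²≡8t+1 = u , refl , odd-square⇒odd (n - t , *-cancelˡ-≡ 4 (u * u) _ (begin
  4 * (u * u)                                ≡⟨ lemma u t ⟩
  2 * u * (2 * u) + (8 * t + 1) - 8 * t - 1  ≡⟨ cong (λ w → 2 * u * (2 * u) + w - 8 * t - 1) y²≡8t+1 ⟨
  2 * u * (2 * u) + y * y - 8 * t - 1        ≡⟨ cong (λ w → w - 8 * t - 1) eq ⟩
  8 * n + 5 - 8 * t - 1                      ≡⟨ lemma′ n t ⟩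
  4 * (2 * (n - t) + 1)                      ∎))
  where
  open ≡-Reasoning
  lemma : ∀ u t → 4 * (u * u) ≡ 2 * u * (2 * u) + (8 * t + 1) - 8 * t - 1
  lemma = solve-∀
  lemma′ : ∀ n t → 8 * n + 5 - 8 * t - 1 ≡ 4 * (2 * (n - t) + 1)
  lemma′ = solve-∀

8n+5-odd : ∀ n → Odd (8 * n + 5)
8n+5-odd n = 4 * n + 2 , lemma n
  where lemma : ∀ n → 8 * n + 5 ≡ 2 * (4 * n + 2) + 1
        lemma = solve-∀

squares-5-mod-8 : ∀ {x y n} → x * x + y * y ≡ 8 * n + 5 →
                  (SinglyEven x × Odd y) ⊎ (Odd x × SinglyEven y)
squares-5-mod-8 {x} {y} {n} eq with even⊎odd x | even⊎odd y
... | inj₁ ex | inj₂ oy = inj₁ (even-summand⇒singlyEven {n = n} ex oy eq , oy)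
... | inj₂ ox | inj₁ ey =
  inj₂ (ox , even-summand⇒singlyEven {n = n} ey ox (trans (+-comm (y * y) (x * x)) eq))
... | inj₁ (a , refl) | inj₁ (b , refl) =
  ⊥-elim (even≢odd (2 * (a * a + b * b) , lemma a b) (8n+5-odd n) eq)
  where lemma : ∀ a b → 2 * a * (2 * a) + 2 * b * (2 * b) ≡ 2 * (2 * (a * a + b * b))
        lemma = solve-∀
... | inj₂ (a , refl) | inj₂ (b , refl) =
  ⊥-elim (even≢odd (2 * (a * a + a + b * b + b) + 1 , lemma a b) (8n+5-odd n) eq)
  where lemma : ∀ a b → (2 * a + 1) * (2 * a + 1) + (2 * b + 1) * (2 * b + 1) ≡
                        2 * (2 * (a * a + a + b * b + b) + 1)
        lemma = solve-∀

pos-8N+5 : ∀ N → + (8 ℕ.* N ℕ.+ 5) ≡ 8 * + N + 5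
pos-8N+5 N = trans (pos-+ (8 ℕ.* N) 5) (cong (_+ 5) (pos-* 8 N))

-i≡i⇒i≡0 : ∀ {i} → - i ≡ i → i ≡ 0
-i≡i⇒i≡0 {i} -i≡i = *-cancelˡ-≡ 2 i 0 (begin
  2 * i     ≡⟨ lemma i ⟩
  i - - i   ≡⟨ cong (λ j → i - j) -i≡i ⟩
  i - i     ≡⟨ lemma′ i ⟩
  0         ∎)
  where
  open ≡-Reasoning
  lemma : ∀ i → 2 * i ≡ i - - i
  lemma = solve-∀
  lemma′ : ∀ i → i - i ≡ 0
  lemma′ = solve-∀

-i≡j⇒i≡-j : ∀ {i j} → - i ≡ j → i ≡ - j
-i≡j⇒i≡-j {i} eq = trans (sym (neg-involutive i)) (cong -_ eq)

act-free : ∀ {x y} → x ≢ 0 → y ≢ 0 → x ≢ y → x ≢ - y →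
           (g : D8) → act g (x , y) ≡ (x , y) → g ≡ e
act-free _ _ _ _ (rˢ 0F false) _ = refl
act-free _ _ x≢y _ (rˢ 0F true) eq = ⊥-elim (x≢y (cong proj₂ eq))
act-free _ _ x≢y _ (rˢ 1F false) eq = ⊥-elim (x≢y (cong proj₂ eq))
act-free x≢0 _ _ _ (rˢ 1F true) eq = ⊥-elim (x≢0 (-i≡i⇒i≡0 (cong proj₁ eq)))
act-free x≢0 _ _ _ (rˢ 2F false) eq = ⊥-elim (x≢0 (-i≡i⇒i≡0 (cong proj₁ eq)))
act-free _ _ _ x≢-y (rˢ 2F true) eq = ⊥-elim (x≢-y (-i≡j⇒i≡-j (cong proj₂ eq)))
act-free _ _ _ x≢-y (rˢ 3F false) eq = ⊥-elim (x≢-y (-i≡j⇒i≡-j (cong proj₂ eq)))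
act-free _ y≢0 _ _ (rˢ 3F true) eq = ⊥-elim (y≢0 (-i≡i⇒i≡0 (cong proj₂ eq)))

norm : ℤ² → ℤ
norm (x , y) = x * x + y * y

norm-r-act : ∀ p → norm (r-act p) ≡ norm p
norm-r-act (x , y) = lemma x y
  where lemma : ∀ x y → - y * - y + x * x ≡ x * x + y * y
        lemma = solve-∀

norm-r-pow : ∀ n p → norm (r-pow n p) ≡ norm p
norm-r-pow zero p = refl
norm-r-pow (suc n) p = trans (norm-r-act (r-pow n p)) (norm-r-pow n p)

norm-s-act : ∀ p → norm (s-act p) ≡ norm p
norm-s-act (x , y) = +-comm (y * y) (x * x)

norm-act : ∀ g p → norm (act g p) ≡ norm p
norm-act (rˢ i false) p = norm-r-pow (toℕ i) p
norm-act (rˢ i true) p = trans (norm-r-pow (toℕ i) (s-act p)) (norm-s-act p)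

neg-neg-pair : ∀ x y → (- - x , - - y) ≡ (x , y)
neg-neg-pair x y = cong₂ _,_ (neg-involutive x) (neg-involutive y)

sign-change-orbit : ∀ {x y x′ y′} → x′ ≡ x ⊎ x′ ≡ - x → y′ ≡ y ⊎ y′ ≡ - y →
                    Σ D8 λ g → act g (x′ , y′) ≡ (x , y)
sign-change-orbit (inj₁ refl) (inj₁ refl) = e , refl
sign-change-orbit {x} (inj₂ refl) (inj₁ refl) = rˢ 1F true , cong (_, _) (neg-involutive x)
sign-change-orbit {x} {y} (inj₁ refl) (inj₂ refl) = rˢ 3F true , neg-neg-pair x y
sign-change-orbit {x} {y} (inj₂ refl) (inj₂ refl) = rˢ 2F false , neg-neg-pair x y

swapped-sign-change-orbit : ∀ {x y x′ y′} → x′ ≡ x ⊎ x′ ≡ - x → y′ ≡ y ⊎ y′ ≡ - y →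
                            Σ D8 λ g → act g (y′ , x′) ≡ (x , y)
swapped-sign-change-orbit (inj₁ refl) (inj₁ refl) = rˢ 0F true , refl
swapped-sign-change-orbit {x} (inj₂ refl) (inj₁ refl) = rˢ 1F false , cong (_, _) (neg-involutive x)
swapped-sign-change-orbit {x} {y} (inj₁ refl) (inj₂ refl) = rˢ 3F false , neg-neg-pair x y
swapped-sign-change-orbit {x} {y} (inj₂ refl) (inj₂ refl) = rˢ 2F true , neg-neg-pair x y

U-8N+5-free : ∀ {N} g p → U (8 ℕ.* N ℕ.+ 5) p → act g p ≡ p → g ≡ e
U-8N+5-free {N} g (x , y) u with squares-5-mod-8 {n = + N} (trans u (pos-8N+5 N))
... | inj₁ (ex , oy) =
  act-free (singlyEven⇒≢0 ex) (odd⇒≢0 oy)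
           (even≢odd (singlyEven⇒even ex) oy)
           (even≢odd (singlyEven⇒even ex) (odd-neg oy)) g
... | inj₂ (ox , ey) =
  act-free (odd⇒≢0 ox) (singlyEven⇒≢0 ey)
           (≢-sym (even≢odd (singlyEven⇒even ey) ox))
           (≢-sym (even≢odd (even-neg (singlyEven⇒even ey)) ox)) g

+-cancelʳ-≡ : ∀ {i j} k → i + k ≡ j + k → i ≡ j
+-cancelʳ-≡ {i} {j} k eq = begin
  i          ≡⟨ lemma i k ⟩
  i + k - k  ≡⟨ cong (_- k) eq ⟩
  j + k - k  ≡⟨ lemma j k ⟨
  j          ∎
  where
  open ≡-Reasoning
  lemma : ∀ i k → i ≡ i + k - k
  lemma = solve-∀

4*q-k≡4*p-k⇒q≡p : ∀ {q p} k → 4 * q - k ≡ 4 * p - k → q ≡ p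
4*q-k≡4*p-k⇒q≡p {q} {p} k eq = *-cancelˡ-≡ 4 q p (+-cancelʳ-≡ (- k) eq)

φ-injective : ∀ {b b′} → φ b ≡ φ b′ → b ≡ b′
φ-injective {_ , _} {_ , _} eq =
  cong₂ _,_ (4*q-k≡4*p-k⇒q≡p 2 (cong proj₁ eq)) (4*q-k≡4*p-k⇒q≡p 1 (cong proj₂ eq))

φ-norm : ∀ q₁ q₂ →
         norm (φ (q₁ , q₂)) ≡ 8 * (2 * (q₁ * q₁) + 2 * (q₂ * q₂) - 2 * q₁ - q₂) + 5
φ-norm = lemma
  where lemma : ∀ q₁ q₂ → (4 * q₁ - 2) * (4 * q₁ - 2) + (4 * q₂ - 1) * (4 * q₂ - 1) ≡
                          8 * (2 * (q₁ * q₁) + 2 * (q₂ * q₂) - 2 * q₁ - q₂) + 5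
        lemma = solve-∀

B'⇒U-φ : ∀ {N} b → B' N b → U (8 ℕ.* N ℕ.+ 5) (φ b)
B'⇒U-φ {N} (q₁ , q₂) (_ , eq) =
  trans (φ-norm q₁ q₂) (trans (cong (λ w → 8 * w + 5) eq) (sym (pos-8N+5 N)))

U-φ⇒B'-equation : ∀ {N} q₁ q₂ → U (8 ℕ.* N ℕ.+ 5) (φ (q₁ , q₂)) →
                  2 * (q₁ * q₁) + 2 * (q₂ * q₂) - 2 * q₁ - q₂ ≡ + N
U-φ⇒B'-equation {N} q₁ q₂ u =
  *-cancelˡ-≡ 8 _ _ (+-cancelʳ-≡ 5 (trans (sym (φ-norm q₁ q₂)) (trans u (pos-8N+5 N))))

U-of-orbit : ∀ {k} g (q p : ℤ²) → act g q ≡ p → U k p → U k q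
U-of-orbit g q@(_ , _) (_ , _) eq u = trans (sym (norm-act g q)) (trans (cong norm eq) u)

φ₁-preimages : ∀ {x} → SinglyEven x → ∃[ q ] (4 * q - 2 ≡ x × 4 * (1 - q) - 2 ≡ - x)
φ₁-preimages (_ , refl , m , refl) = m + 1 , lemma m , lemma′ m
  where
  lemma : ∀ m → 4 * (m + 1) - 2 ≡ 2 * (2 * m + 1)
  lemma = solve-∀
  lemma′ : ∀ m → 4 * (1 - (m + 1)) - 2 ≡ - (2 * (2 * m + 1))
  lemma′ = solve-∀

φ₂-preimage : ∀ {y} → Odd y → ∃[ q ] (4 * q - 1 ≡ y ⊎ 4 * q - 1 ≡ - y)
φ₂-preimage (n , refl) with even⊎odd n
... | inj₁ (k , refl) = - k , inj₂ (lemma k)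
  where lemma : ∀ k → 4 * - k - 1 ≡ - (2 * (2 * k) + 1)
        lemma = solve-∀
... | inj₂ (k , refl) = k + 1 , inj₁ (lemma k)
  where lemma : ∀ k → 4 * (k + 1) - 1 ≡ 2 * (2 * k + 1) + 1
        lemma = solve-∀

φ-preimage-up-to-signs : ∀ {x y} → SinglyEven x → Odd y →
  ∃[ q₁ ] ∃[ q₂ ] (Even (q₁ + q₂) × (4 * q₁ - 2 ≡ x ⊎ 4 * q₁ - 2 ≡ - x)
                                 × (4 * q₂ - 1 ≡ y ⊎ 4 * q₂ - 1 ≡ - y))
φ-preimage-up-to-signs ex oy with φ₁-preimages ex | φ₂-preimage oy
... | q₁ , eq , eq′ | q₂ , sy with even⊎complement-even q₁ q₂
...   | inj₁ ev = q₁ , q₂ , ev , inj₁ eq , sy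
...   | inj₂ ev = 1 - q₁ , q₂ , ev , inj₂ eq′ , sy

B'-of-orbit : ∀ {N} q₁ q₂ g p → Even (q₁ + q₂) → act g (φ (q₁ , q₂)) ≡ p →
              U (8 ℕ.* N ℕ.+ 5) p → B' N (q₁ , q₂)
B'-of-orbit q₁ q₂ g p ev eq u = even⇒2∣ ev , U-φ⇒B'-equation q₁ q₂ (U-of-orbit g _ p eq u)

φ-orbit-representative : ∀ {N} p → U (8 ℕ.* N ℕ.+ 5) p →
                         Σ ℤ² λ b → B' N b × Σ D8 λ g → act g (φ b) ≡ p
φ-orbit-representative {N} p@(x , y) u with squares-5-mod-8 {n = + N} (trans u (pos-8N+5 N))
... | inj₁ (ex , oy) =
  let q₁ , q₂ , ev , sx , sy = φ-preimage-up-to-signs ex oy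
      g , eq = sign-change-orbit sx sy
  in (q₁ , q₂) , B'-of-orbit q₁ q₂ g p ev eq u , g , eq
... | inj₂ (ox , ey) =
  let q₁ , q₂ , ev , sy , sx = φ-preimage-up-to-signs ey ox
      g , eq = swapped-sign-change-orbit sx sy
  in (q₁ , q₂) , B'-of-orbit q₁ q₂ g p ev eq u , g , eq

even[4q-2] : ∀ q → Even (4 * q - 2)
even[4q-2] q = 2 * q - 1 , lemma q
  where lemma : ∀ q → 4 * q - 2 ≡ 2 * (2 * q - 1)
        lemma = solve-∀

odd[4q-1] : ∀ q → Odd (4 * q - 1)
odd[4q-1] q = 2 * q - 1 , lemma q
  where lemma : ∀ q → 4 * q - 1 ≡ 2 * (2 * q - 1) + 1
        lemma = solve-∀

-[4q-2]≡4p-2⇒p≡1-q : ∀ {q p} → - (4 * q - 2) ≡ 4 * p - 2 → p ≡ 1 - q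
-[4q-2]≡4p-2⇒p≡1-q {q} {p} eq = 4*q-k≡4*p-k⇒q≡p 2 (trans (sym eq) (lemma q))
  where lemma : ∀ q → - (4 * q - 2) ≡ 4 * (1 - q) - 2
        lemma = solve-∀

-- The two sides differ by 2 mod 4.
-[4q-1]≢4p-1 : ∀ q p → - (4 * q - 1) ≢ 4 * p - 1
-[4q-1]≢4p-1 q p eq = 2*i≢1 (q + p) (*-cancelˡ-≡ 2 _ _ (begin
  2 * (2 * (q + p))                   ≡⟨ lemma q p ⟩
  4 * p - 1 - - (4 * q - 1) + 2       ≡⟨ cong (λ w → w - - (4 * q - 1) + 2) eq ⟨
  - (4 * q - 1) - - (4 * q - 1) + 2   ≡⟨ lemma′ q ⟩
  2 * 1                               ∎))
  where
  open ≡-Reasoning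
  lemma : ∀ q p → 2 * (2 * (q + p)) ≡ 4 * p - 1 - - (4 * q - 1) + 2
  lemma = solve-∀
  lemma′ : ∀ q → - (4 * q - 1) - - (4 * q - 1) + 2 ≡ 2 * 1
  lemma′ = solve-∀

φ-orbit-injective : ∀ q₁ q₂ p₁ p₂ → Even (q₁ + q₂) → Even (p₁ + p₂) →
                    (g : D8) → act g (φ (q₁ , q₂)) ≡ φ (p₁ , p₂) → (q₁ , q₂) ≡ (p₁ , p₂)
φ-orbit-injective _ _ _ _ _ _ (rˢ 0F false) eq = φ-injective eq
φ-orbit-injective _ q₂ p₁ _ _ _ (rˢ 0F true) eq =
  ⊥-elim (even≢odd (even[4q-2] p₁) (odd[4q-1] q₂) (sym (cong proj₁ eq)))
φ-orbit-injective _ q₂ p₁ _ _ _ (rˢ 1F false) eq =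
  ⊥-elim (even≢odd (even[4q-2] p₁) (odd-neg (odd[4q-1] q₂)) (sym (cong proj₁ eq)))
φ-orbit-injective q₁ q₂ p₁ p₂ ev ev′ (rˢ 1F true) eq
  with -[4q-2]≡4p-2⇒p≡1-q {q₁} {p₁} (cong proj₁ eq)
     | 4*q-k≡4*p-k⇒q≡p {q₂} {p₂} 1 (cong proj₂ eq)
... | refl | refl = ⊥-elim (¬even×complement-even q₁ q₂ ev ev′)
φ-orbit-injective _ q₂ _ p₂ _ _ (rˢ 2F false) eq = ⊥-elim (-[4q-1]≢4p-1 q₂ p₂ (cong proj₂ eq))
φ-orbit-injective _ q₂ p₁ _ _ _ (rˢ 2F true) eq =
  ⊥-elim (even≢odd (even[4q-2] p₁) (odd-neg (odd[4q-1] q₂)) (sym (cong proj₁ eq)))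
φ-orbit-injective _ q₂ p₁ _ _ _ (rˢ 3F false) eq =
  ⊥-elim (even≢odd (even[4q-2] p₁) (odd-neg (odd-neg (odd[4q-1] q₂))) (sym (cong proj₁ eq)))
φ-orbit-injective _ q₂ _ p₂ _ _ (rˢ 3F true) eq = ⊥-elim (-[4q-1]≢4p-1 q₂ p₂ (cong proj₂ eq))

theorem8p8 : (N : ℕ) →
    ((g : D8) (p : ℤ²) → U (8 ℕ.* N ℕ.+ 5) p → act g p ≡ p → g ≡ e)
    ×
    (((b : ℤ²) → B' N b → U (8 ℕ.* N ℕ.+ 5) (φ b))
     × ((p : ℤ²) → U (8 ℕ.* N ℕ.+ 5) p →
          Σ ℤ² (λ b → B' N b × Σ D8 (λ g → act g (φ b) ≡ p)))
     × ((b b′ : ℤ²) → B' N b → B' N b′ → (g : D8) → act g (φ b) ≡ φ b′ → b ≡ b′))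
theorem8p8 N =
    U-8N+5-free {N}
  , B'⇒U-φ
  , φ-orbit-representative
  , λ { (q₁ , q₂) (p₁ , p₂) (2∣q₁+q₂ , _) (2∣p₁+p₂ , _) →
        φ-orbit-injective q₁ q₂ p₁ p₂ (2∣⇒even 2∣q₁+q₂) (2∣⇒even 2∣p₁+p₂) }
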